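{- Let $G$ be a finite, simple, connected graph with $A(G)\neq\emptyset$, and let $G^*$ be the bipartite graph with bipartition $(A,D^*)$, $A=A(G)$, defined in the context. Let $M_c\subseteq E(G^*)$ be a matching $D^*$-cover of $G^*$ with $A$-vertices being centers, such that no matching $D^*$-cover $M'$ of $G^*$ with $A$-vertices being centers and with $\Delta(G^*[M']+A)=\Delta(G^*[M_c]+A)$ has fewer maximum centers than $M_c$. Then $M_c$ is an optimal matching $D^*$-cover of $G^*$ (i.e. $\Delta(G^*[M_c]+A)=md(G^*)$) if and only if $G^*$ contains no $M_c$-switching path.
   Context: Definitions. $D(G)$ is the set of vertices of $G$ missed by some maximum matching of $G$; $A(G)=N_G(D(G))$; $C(G)=V(G)\setminus(A(G)\cup D(G))$. $D^*$ is the set of isolated vertices of $G[D(G)]$, and $G^*$ is obtained from $G$ by deleting the vertices of the nontrivial components of $G[D(G)]$, the vertices of $C(G)$, and all edges with both ends in $A(G)$; it is bipartite with bipartition $(A,D^*)$, $A=A(G)$. A $k$-matching $D^*$-cover of $G^*$ is a union of $k$ matchings of $G^*$ covering every vertex of $D^*$; $md(G^*)$ is the least such $k$, and a $D^*$-cover that is a union of $md(G^*)$ matchings is optimal. A matching $D^*$-cover with $A$-vertices being centers is an edge set $M_c\subseteq E(G^*)$ in which every vertex of $D^*$ has degree exactly $1$ (equivalently an inclusion-minimal matching $D^*$-cover); then every component of $G^*[M_c]$ is a star centred at a vertex of $A$, all vertices of $A$ are called centers of $M_c$ and the vertices of $D^*$ are its ends, and $M_c$ is a union of $\Delta(G^*[M_c])$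 matchings. $G^*[M_c]+A$ denotes the graph $G^*[M_c]$ (subgraph formed by the edges of $M_c$) together with the vertices of $A$ not covered by $M_c$ added as isolated vertices. A center $w$ is a maximum center if $d_{G^*[M_c]+A}(w)=\Delta(G^*[M_c]+A)$. An $M_c$-alternating path is a path in $G^*$ starting at a center $u$ with an edge of $M_c$ incident to $u$, whose vertices are alternately centers and ends and whose edges are alternately in $M_c$ and in $E(G^*)\setminus M_c$. Such a path $P_{uv}$ from $u$ to $v$ is an $M_c$-switching path if $v$ is a center, $u$ is a maximum center, and $d_{G^*[M_c]+A}(u)\geq d_{G^*[M_c]+A}(v)+2$. -}

module Defs where

open import Data.Nat using (ℕ; zero; suc; _+_; _≤_; _<_)
open import Data.Bool using (Bool; true; false; if_then_else_; _∧_)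
open import Data.Fin using (Fin; _<?_)
open import Data.List using (List; []; _∷_; map; allFin)
open import Data.Nat.ListAction using (sum)
open import Data.List.Relation.Unary.Unique.Propositional using (Unique)
open import Data.Fin.Subset using (Subset; ∣_∣) renaming (_∈_ to _∈ₛ_)
open import Data.Product using (Σ; _×_; ∃; ∃-syntax)
open import Data.Sum using (_⊎_)
open import Relation.Nullary using (¬_; ⌊_⌋)
open import Relation.Binary.PropositionalEquality using (_≡_)
open import Function.Bundles using (_⇔_)

record Graph (n : ℕ) : Set where
  field
    adj    : Fin n → Fin n → Bool
    sym    : ∀ u v → adj u v ≡ adj v u
    irrefl : ∀ v → adj v v ≡ false
open Graph public

data Reach {n : ℕ} (G : Graph n) : Fin n → Fin n → Set where
  here  : ∀ {v} → Reach G v v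
  there : ∀ {u w v} → adj G u w ≡ true → Reach G w v → Reach G u v

Connected : ∀ {n} → Graph n → Set
Connected G = ∀ u v → Reach G u v

EdgeSet : ℕ → Set
EdgeSet n = Fin n → Fin n → Bool

Symmetric : ∀ {n} → EdgeSet n → Set
Symmetric M = ∀ u v → M u v ≡ M v u

deg : ∀ {n} → EdgeSet n → Fin n → ℕ
deg {n} M v = sum (map (λ u → if M v u then 1 else 0) (allFin n))

size : ∀ {n} → EdgeSet n → ℕ
size {n} M = sum (map (λ u → sum (map (λ v → if M u v ∧ ⌊ u <? v ⌋ then 1 else 0) (allFin n))) (allFin n))

IsMatching : ∀ {n} → Graph n → EdgeSet n → Set
IsMatching G M = Symmetric M × (∀ u v → M u v ≡ true → adj G u v ≡ true) × (∀ v → deg M v ≤ 1)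

IsMaxMatching : ∀ {n} → Graph n → EdgeSet n → Set
IsMaxMatching G M = IsMatching G M × (∀ M' → IsMatching G M' → size M' ≤ size M)

InD : ∀ {n} → Graph n → Fin n → Set
InD G v = Σ _ λ M → IsMaxMatching G M × deg M v ≡ 0

InA : ∀ {n} → Graph n → Fin n → Set
InA G v = ¬ InD G v × (Σ _ λ u → InD G u × adj G u v ≡ true)

InD* : ∀ {n} → Graph n → Fin n → Set
InD* G v = InD G v × (∀ u → InD G u → adj G v u ≡ false)

StarEdge : ∀ {n} → Graph n → Fin n → Fin n → Set
StarEdge G u v = adj G u v ≡ true × ((InA G u × InD* G v) ⊎ (InD* G u × InA G v))

InStar : ∀ {n} → Graph n → EdgeSet n → Set
InStar G M = ∀ u v → M u v ≡ true → StarEdge G u v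

IsStarMatching : ∀ {n} → Graph n → EdgeSet n → Set
IsStarMatching G M = Symmetric M × InStar G M × (∀ v → deg M v ≤ 1)

HasCover : ∀ {n} → Graph n → ℕ → Set
HasCover {n} G k = Σ (Fin k → EdgeSet n) λ Ms →
  (∀ i → IsStarMatching G (Ms i)) ×
  (∀ v → InD* G v → Σ (Fin k) λ i → Σ (Fin n) λ u → Ms i v u ≡ true)

IsMd : ∀ {n} → Graph n → ℕ → Set
IsMd G k = HasCover G k × (∀ k' → HasCover G k' → k ≤ k')

IsCenterCover : ∀ {n} → Graph n → EdgeSet n → Set
IsCenterCover G M = Symmetric M × InStar G M × (∀ v → InD* G v → deg M v ≡ 1)

InVset : ∀ {n} → Graph n → EdgeSet n → Fin n → Set
InVset G M v = InA G v ⊎ (1 ≤ deg M v)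

HasΔ : ∀ {n} → Graph n → EdgeSet n → ℕ → Set
HasΔ G M k = (∀ v → InVset G M v → deg M v ≤ k) × (Σ _ λ v → InVset G M v × deg M v ≡ k)

IsMaxCenter : ∀ {n} → Graph n → EdgeSet n → Fin n → Set
IsMaxCenter G M w = InA G w × (∀ v → InVset G M v → deg M v ≤ deg M w)

NumMaxCenters : ∀ {n} → Graph n → EdgeSet n → ℕ → Set
NumMaxCenters {n} G M N = Σ (Subset n) λ S → (∀ w → (w ∈ₛ S) ⇔ IsMaxCenter G M w) × ∣ S ∣ ≡ N

data Alt {n : ℕ} (G : Graph n) (M : EdgeSet n) : Fin n → List (Fin n) → Fin n → Set where
  stop : ∀ {v} → InA G v → Alt G M v (v ∷ []) v
  step : ∀ {u e w vs v} → InA G u → InD* G e →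
         StarEdge G u e → M u e ≡ true →
         StarEdge G e w → M e w ≡ false →
         Alt G M w vs v → Alt G M u (u ∷ e ∷ vs) v

SwitchingPath : ∀ {n} → Graph n → EdgeSet n → Fin n → Fin n → Set
SwitchingPath {n} G M u v =
  Σ (Fin n) λ e → Σ (List (Fin n)) λ vs →
    Alt G M u (u ∷ e ∷ vs) v × Unique (u ∷ e ∷ vs) ×
    IsMaxCenter G M u × deg M v + 2 ≤ deg M u

HasSwitchingPath : ∀ {n} → Graph n → EdgeSet n → Set
HasSwitchingPath {n} G M = Σ (Fin n) λ u → Σ (Fin n) λ v → SwitchingPath G M u v

-- Write d for Δ(G*[M_c] + A). If there is an M_c-switching path from u to v, exchanging the M_c-edges of
-- the path for its other edges lowers the degree of the maximum centre u by one, raises that of v by one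
-- (to at most d - 1) and changes no other degree. If another centre still has degree d, this is a cover
-- with the same Δ and fewer maximum centres, against the choice of M_c; otherwise it has Δ = d - 1, so
-- d is not optimal.
-- Conversely, M_c splits into d matchings (colour each edge by the rank of its end among the ends of its
-- centre). Suppose matchings M_1, ..., M_k cover D*. Grow from a maximum centre u the set S of
-- centres reachable by alternating paths that continue from an end along an M_i-edge. Without switching
-- paths every centre in S has degree at least d - 1, so at least (d - 1)|S| + 1 ends are matched into S.
-- Since S is closed, each of them is covered by an M_i-edge into S; there are at most k|S| such edges,
-- so k ≥ d.

module Submission where

open import Defs hiding (sym)
open import Data.Bool using (Bool; true; false; if_then_else_; _∧_; _∨_; not)
import Data.Bool.Properties as Bool
open import Data.Bool.Properties
  using (∧-zeroʳ; ∧-comm; ∧-identityʳ; ∨-comm; ∨-zeroʳ; ∨-identityʳ; ¬-not; not-¬)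
open import Data.Empty using (⊥)
open import Data.Fin using (Fin; zero; suc; toℕ; fromℕ<) renaming (_<_ to _<ᶠ_)
import Data.Fin.Properties as Fin
open import Data.Fin.Subset using (Subset; ∣_∣; _⊂_) renaming (_∈_ to _∈ₛ_)
open import Data.Fin.Subset.Properties using (p⊂q⇒∣p∣<∣q∣)
open import Data.List using (List; []; _∷_; _++_; map; allFin; tabulate)
open import Data.List.Properties using (map-tabulate)
open import Data.List.Relation.Unary.All using (All; []; _∷_)
import Data.List.Relation.Unary.All as All
import Data.List.Relation.Unary.All.Properties as All
open import Data.List.Relation.Unary.AllPairs using ([]; _∷_)
import Data.List.Relation.Unary.AllPairs.Properties as AllPairs
open import Data.List.Relation.Unary.Unique.Propositional using (Unique)
open import Data.Nat using (ℕ; zero; suc; pred; _+_; _*_; _≤_; _<_; z≤n; s≤s; _≤?_) renaming (_≟_ to _≟ℕ_)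
open import Data.Nat.Induction using (<-wellFounded)
import Data.Nat.ListAction as List
open import Data.Nat.Properties
open import Algebra.Properties.CommutativeSemigroup +-commutativeSemigroup using (x∙yz≈xz∙y; xy∙z≈xz∙y)
open import Algebra.Properties.Semiring.Sum +-*-semiring
  using (sum; sum-syntax; sum-cong-≗; sum-replicate-zero; ∑-distrib-+; ∑-comm; *-distribʳ-sum)
open import Data.Product using (Σ; _×_; _,_; proj₁; proj₂; ∃)
open import Data.Sum using (_⊎_; inj₁; inj₂; [_,_])
import Data.Vec as Vec
import Data.Vec.Properties as Vec
open import Function using (_∘_)
open import Function.Bundles using (_⇔_; mk⇔; Equivalence)
open import Induction.WellFounded using (Acc; acc)
open import Relation.Binary using (tri<; tri≈; tri>)
open import Relation.Binary.PropositionalEquality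
  using (_≡_; _≢_; refl; sym; trans; cong; cong₂; subst; subst₂; module ≡-Reasoning)
open import Relation.Nullary using (¬_; does; yes; no; contradiction)
open import Relation.Nullary.Decidable using (Dec; dec-true; dec-false; ¬?; _×-dec_)

does-true : ∀ {a} {A : Set a} (a? : Dec A) → does a? ≡ true → A
does-true (yes a) _ = a

∧-intro : ∀ {a b} → a ≡ true → b ≡ true → a ∧ b ≡ true
∧-intro refl refl = refl

∧-elim : ∀ {a b} → a ∧ b ≡ true → a ≡ true × b ≡ true
∧-elim {true} {true} _ = refl , refl

∨-elim : ∀ {a b} → a ∨ b ≡ true → a ≡ true ⊎ b ≡ true
∨-elim {true}  _   = inj₁ refl
∨-elim {false} b≡t = inj₂ b≡t

n≰pred[n] : ∀ {n} → 1 ≤ n → ¬ n ≤ pred n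
n≰pred[n] (s≤s z≤n) = 1+n≰n

≤1⇒≤ : ∀ {m n} → m ≤ 1 → (0 < m → 1 ≤ n) → m ≤ n
≤1⇒≤ z≤n       _   = z≤n
≤1⇒≤ (s≤s z≤n) pos = pos (s≤s z≤n)

+-telescope : ∀ a b c u v w → a + w ≡ b + v → b + u ≡ c + w → a + u ≡ c + v
+-telescope a b c u v w a+w≡b+v b+u≡c+w = +-cancelʳ-≡ w _ _ (begin
  a + u + w ≡⟨ xy∙z≈xz∙y a u w ⟩
  a + w + u ≡⟨ cong (_+ u) a+w≡b+v ⟩
  b + v + u ≡⟨ xy∙z≈xz∙y b v u ⟩
  b + u + v ≡⟨ cong (_+ v) b+u≡c+w ⟩
  c + w + v ≡⟨ xy∙z≈xz∙y c w v ⟩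
  c + v + w ∎)
  where open ≡-Reasoning

∑-mono-≤ : ∀ {n} {f g : Fin n → ℕ} → (∀ i → f i ≤ g i) → sum f ≤ sum g
∑-mono-≤ {zero}  f≤g = z≤n
∑-mono-≤ {suc n} f≤g = +-mono-≤ (f≤g zero) (∑-mono-≤ (f≤g ∘ suc))

∑-mono-< : ∀ {n} {f g : Fin n → ℕ} {j} → (∀ i → f i ≤ g i) → f j < g j → sum f < sum g
∑-mono-< {j = zero}  f≤g fj<gj = +-mono-<-≤ fj<gj (∑-mono-≤ (f≤g ∘ suc))
∑-mono-< {j = suc j} f≤g fj<gj = +-mono-≤-< (f≤g zero) (∑-mono-< (f≤g ∘ suc) fj<gj)

term≤∑ : ∀ {n} (f : Fin n → ℕ) i → f i ≤ sum f
term≤∑ f zero    = m≤m+n _ _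
term≤∑ f (suc i) = ≤-trans (term≤∑ (f ∘ suc) i) (m≤n+m _ (f zero))

∑-const : ∀ n c → ∑[ i < n ] c ≡ n * c
∑-const zero    c = refl
∑-const (suc n) c = cong (c +_) (∑-const n c)

sum-allFin : ∀ {n} (f : Fin n → ℕ) → List.sum (map f (allFin n)) ≡ sum f
sum-allFin {n} f = trans (cong List.sum (map-tabulate {n = n} (λ i → i) f)) (sum-tabulate f)
  where
  sum-tabulate : ∀ {n} (f : Fin n → ℕ) → List.sum (tabulate f) ≡ sum f
  sum-tabulate {zero}  f = refl
  sum-tabulate {suc n} f = cong (f zero +_) (sum-tabulate (f ∘ suc))

iverson : Bool → ℕ
iverson b = if b then 1 else 0

iverson-mono : ∀ {a b} → (a ≡ true → b ≡ true) → iverson a ≤ iverson b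
iverson-mono {false} a⇒b = z≤n
iverson-mono {true}  a⇒b rewrite a⇒b refl = ≤-refl

count : ∀ {n} → (Fin n → Bool) → ℕ
count p = sum (iverson ∘ p)

δ : ∀ {n} → Fin n → Fin n → ℕ
δ a x = iverson (does (x Fin.≟ a))

δ-refl : ∀ {n} (a : Fin n) → δ a a ≡ 1
δ-refl a rewrite dec-true (a Fin.≟ a) refl = refl

δ-≢ : ∀ {n} {a x : Fin n} → x ≢ a → δ a x ≡ 0
δ-≢ {a = a} {x} x≢a rewrite dec-false (x Fin.≟ a) x≢a = refl

∑δ : ∀ {n} (a : Fin n) → sum (δ a) ≡ 1
∑δ {suc n} zero    = cong suc (sum-replicate-zero n)
∑δ {suc n} (suc a) = ∑δ a

count-∧ˡ : ∀ {n} b (p : Fin n → Bool) → count (λ i → b ∧ p i) ≡ iverson b * count p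
count-∧ˡ {n} false p = sum-replicate-zero n
count-∧ˡ     true  p = sym (+-identityʳ (count p))

count>0⇒∃ : ∀ {n} (p : Fin n → Bool) → 0 < count p → ∃ λ i → p i ≡ true
count>0⇒∃ {suc n} p pos with p zero in eq
... | true  = zero , eq
... | false = let i , pi = count>0⇒∃ (p ∘ suc) pos in suc i , pi

1≤count : ∀ {n} (p : Fin n → Bool) {i} → p i ≡ true → 1 ≤ count p
1≤count p {i} pi = subst (λ b → iverson b ≤ count p) pi (term≤∑ (iverson ∘ p) i)

2≤count : ∀ {n} (p : Fin n → Bool) {i j} → i ≢ j → p i ≡ true → p j ≡ true → 2 ≤ count p
2≤count p {zero}  {zero}  i≢j _  _  = contradiction refl i≢j
2≤count p {zero}  {suc j} _   pi pj rewrite pi = s≤s (1≤count (p ∘ suc) pj)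
2≤count p {suc i} {zero}  i≢j pi pj = 2≤count p (i≢j ∘ sym) pj pi
2≤count p {suc i} {suc j} i≢j pi pj =
  ≤-trans (2≤count (p ∘ suc) (i≢j ∘ cong suc) pi pj) (m≤n+m _ (iverson (p zero)))

count≤1 : ∀ {n} (p : Fin n → Bool) → (∀ i j → p i ≡ true → p j ≡ true → i ≡ j) → count p ≤ 1
count≤1 {zero}  p uniq = z≤n
count≤1 {suc n} p uniq with p zero in eq
... | false = count≤1 (p ∘ suc) (λ i j pi pj → Fin.suc-injective (uniq (suc i) (suc j) pi pj))
... | true  = s≤s (≤-reflexive (trans (sum-cong-≗ rest) (sum-replicate-zero n)))
  where
  rest : ∀ i → iverson (p (suc i)) ≡ 0
  rest i with p (suc i) in eqi
  ... | false = refl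
  ... | true  with () ← uniq zero (suc i) eq eqi

count-mono : ∀ {n} {p q : Fin n → Bool} → (∀ i → p i ≡ true → q i ≡ true) → count p ≤ count q
count-mono p⊆q = ∑-mono-≤ (λ i → iverson-mono (p⊆q i))

count-⊂ : ∀ {n} {p q : Fin n → Bool} {j} → (∀ i → p i ≡ true → q i ≡ true) →
          p j ≡ false → q j ≡ true → count p < count q
count-⊂ {j = j} p⊆q pj qj =
  ∑-mono-< {j = j} (λ i → iverson-mono (p⊆q i))
    (subst₂ (λ a b → iverson a < iverson b) (sym pj) (sym qj) ≤-refl)

∈-tabulate⇔ : ∀ {n} (f : Fin n → Bool) x → x ∈ₛ Vec.tabulate f ⇔ f x ≡ true
∈-tabulate⇔ f x = mk⇔ (λ x∈ → trans (sym (Vec.lookup∘tabulate f x)) (Vec.[]=⇒lookup x∈))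
                      (λ fx → Vec.lookup⇒[]= x (Vec.tabulate f) (trans (Vec.lookup∘tabulate f x) fx))

deg≡count : ∀ {n} (M : EdgeSet n) v → deg M v ≡ count (M v)
deg≡count M v = sum-allFin (iverson ∘ M v)

deg-mono : ∀ {n} {M M' : EdgeSet n} v → (∀ y → M v y ≡ true → M' v y ≡ true) → deg M v ≤ deg M' v
deg-mono {M = M} {M'} v M⊆M' = subst₂ _≤_ (sym (deg≡count M v)) (sym (deg≡count M' v)) (count-mono M⊆M')

deg≤1 : ∀ {n} (M : EdgeSet n) v → (∀ y y' → M v y ≡ true → M v y' ≡ true → y ≡ y') → deg M v ≤ 1
deg≤1 M v uniq = subst (_≤ 1) (sym (deg≡count M v)) (count≤1 (M v) uniq)

neighbour : ∀ {n} (M : EdgeSet n) v → 0 < deg M v → ∃ λ y → M v y ≡ true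
neighbour M v pos = count>0⇒∃ (M v) (subst (0 <_) (deg≡count M v) pos)

neighbour-unique : ∀ {n} (M : EdgeSet n) {v a b} → deg M v ≤ 1 → M v a ≡ true → M v b ≡ true → a ≡ b
neighbour-unique M {v} {a} {b} deg-v≤1 Mva Mvb with a Fin.≟ b
... | yes a≡b = a≡b
... | no  a≢b = contradiction (≤-trans (2≤count (M v) a≢b Mva Mvb) (subst (_≤ 1) (deg≡count M v) deg-v≤1))
                              (λ { (s≤s ()) })

module _ {n : ℕ} where

  edge : Fin n → Fin n → EdgeSet n
  edge a b x y = (does (x Fin.≟ a) ∧ does (y Fin.≟ b)) ∨ (does (x Fin.≟ b) ∧ does (y Fin.≟ a))

  edge-elim : ∀ {a b x y} → edge a b x y ≡ true → (x ≡ a × y ≡ b) ⊎ (x ≡ b × y ≡ a)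
  edge-elim {a} {b} {x} {y} h with ∨-elim {does (x Fin.≟ a) ∧ does (y Fin.≟ b)} h
  ... | inj₁ ab = let x≡a , y≡b = ∧-elim {does (x Fin.≟ a)} ab in
                  inj₁ (does-true (x Fin.≟ a) x≡a , does-true (y Fin.≟ b) y≡b)
  ... | inj₂ ba = let x≡b , y≡a = ∧-elim {does (x Fin.≟ b)} ba in
                  inj₂ (does-true (x Fin.≟ b) x≡b , does-true (y Fin.≟ a) y≡a)

  edge-sym : ∀ a b x y → edge a b x y ≡ edge a b y x
  edge-sym a b x y = trans (∨-comm (does (x Fin.≟ a) ∧ _) _)
    (cong₂ _∨_ (∧-comm (does (x Fin.≟ b)) _) (∧-comm (does (x Fin.≟ a)) _))

  edge-avoiding : ∀ {a b c x y} → (a ≡ c ⊎ b ≡ c) → x ≢ c → y ≢ c → edge a b x y ≡ false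
  edge-avoiding (inj₁ refl) x≢c y≢c = ¬-not ([ x≢c ∘ proj₁ , y≢c ∘ proj₂ ] ∘ edge-elim)
  edge-avoiding (inj₂ refl) x≢c y≢c = ¬-not ([ y≢c ∘ proj₂ , x≢c ∘ proj₁ ] ∘ edge-elim)

  count-edge : ∀ {a b} → a ≢ b → ∀ x → count (edge a b x) ≡ δ a x + δ b x
  count-edge {a} {b} a≢b x with x Fin.≟ a | x Fin.≟ b
  ... | yes refl | yes refl = contradiction refl a≢b
  ... | yes refl | no _     = trans (sum-cong-≗ (λ y → cong iverson (∨-identityʳ (does (y Fin.≟ b))))) (∑δ b)
  ... | no _     | yes refl = ∑δ a
  ... | no _     | no _     = sum-replicate-zero n

  reroute : EdgeSet n → Fin n → Fin n → Fin n → EdgeSet n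
  reroute M u e w x y = (M x y ∧ not (edge u e x y)) ∨ edge e w x y

iverson-reroute : ∀ m p q → (p ≡ true → m ≡ true) → (q ≡ true → m ≡ false) →
                  iverson ((m ∧ not p) ∨ q) + iverson p ≡ iverson m + iverson q
iverson-reroute true  true  true  _ q⇒¬m = contradiction (q⇒¬m refl) λ ()
iverson-reroute true  true  false _ _    = refl
iverson-reroute true  false true  _ q⇒¬m = contradiction (q⇒¬m refl) λ ()
iverson-reroute true  false false _ _    = refl
iverson-reroute false true  _     p⇒m _  = contradiction (p⇒m refl) λ ()
iverson-reroute false false true  _ _    = refl
iverson-reroute false false false _ _    = refl

deg-reroute : ∀ {n} (M : EdgeSet n) {u e w} → u ≢ e → e ≢ w →
              (∀ x y → edge u e x y ≡ true → M x y ≡ true) →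
              (∀ x y → edge e w x y ≡ true → M x y ≡ false) →
              ∀ x → deg (reroute M u e w) x + δ u x ≡ deg M x + δ w x
deg-reroute M {u} {e} {w} u≢e e≢w ue⊆M ew∩M=∅ x = +-cancelʳ-≡ (δ e x) _ _ (begin
  deg M' x + δ u x + δ e x                 ≡⟨ +-assoc (deg M' x) _ _ ⟩
  deg M' x + (δ u x + δ e x)               ≡⟨ cong₂ _+_ (deg≡count M' x) (sym (count-edge u≢e x)) ⟩
  count (M' x) + count (edge u e x)        ≡⟨ ∑-distrib-+ (iverson ∘ M' x) (iverson ∘ edge u e x) ⟨
  ∑[ y < _ ] (iverson (M' x y) + iverson (edge u e x y))
    ≡⟨ sum-cong-≗ (λ y → iverson-reroute (M x y) _ _ (ue⊆M x y) (ew∩M=∅ x y)) ⟩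
  ∑[ y < _ ] (iverson (M x y) + iverson (edge e w x y))
    ≡⟨ ∑-distrib-+ (iverson ∘ M x) (iverson ∘ edge e w x) ⟩
  count (M x) + count (edge e w x)         ≡⟨ cong₂ _+_ (sym (deg≡count M x)) (count-edge e≢w x) ⟩
  deg M x + (δ e x + δ w x)                ≡⟨ x∙yz≈xz∙y (deg M x) _ _ ⟩
  deg M x + δ w x + δ e x                  ∎)
  where
  open ≡-Reasoning
  M' = reroute M u e w

-- Centre covers of G*

module _ {n} (G : Graph n) where

  InA⇒¬InD* : ∀ {v} → InA G v → ¬ InD* G v
  InA⇒¬InD* v∈A v∈D* = proj₁ v∈A (proj₁ v∈D*)

  A≢D* : ∀ {a d} → InA G a → InD* G d → a ≢ d
  A≢D* a∈A d∈D* refl = InA⇒¬InD* a∈A d∈D*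

  StarEdge-sym : ∀ {a b} → StarEdge G a b → StarEdge G b a
  StarEdge-sym {a} {b} (ab , inj₁ (a∈A , b∈D*)) = trans (Graph.sym G b a) ab , inj₂ (b∈D* , a∈A)
  StarEdge-sym {a} {b} (ab , inj₂ (a∈D* , b∈A)) = trans (Graph.sym G b a) ab , inj₁ (b∈A , a∈D*)

  StarEdge-A→D* : ∀ {a b} → StarEdge G a b → InA G a → InD* G b
  StarEdge-A→D* (_ , inj₁ (_ , b∈D*)) _   = b∈D*
  StarEdge-A→D* (_ , inj₂ (a∈D* , _)) a∈A = contradiction a∈D* (InA⇒¬InD* a∈A)

  StarEdge-D*→A : ∀ {a b} → StarEdge G a b → InD* G a → InA G b
  StarEdge-D*→A (_ , inj₁ (a∈A , _)) a∈D* = contradiction a∈D* (InA⇒¬InD* a∈A)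
  StarEdge-D*→A (_ , inj₂ (_ , b∈A)) _    = b∈A

  StarEdge-end : ∀ {a b} → StarEdge G a b → ∃ (InD* G)
  StarEdge-end (_ , inj₁ (_ , b∈D*)) = _ , b∈D*
  StarEdge-end (_ , inj₂ (a∈D* , _)) = _ , a∈D*

  module CenterCover {M : EdgeSet n} (cc : IsCenterCover G M) where

    M-sym : Symmetric M
    M-sym = proj₁ cc

    M⊆G* : InStar G M
    M⊆G* = proj₁ (proj₂ cc)

    deg-end : ∀ {e} → InD* G e → deg M e ≡ 1
    deg-end = proj₂ (proj₂ cc) _

    center→end : ∀ {a e} → InA G a → M a e ≡ true → InD* G e
    center→end a∈A Mae = StarEdge-A→D* (M⊆G* _ _ Mae) a∈A

    end→center : ∀ {e a} → InD* G e → M e a ≡ true → InA G a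
    end→center e∈D* Mea = StarEdge-D*→A (M⊆G* _ _ Mea) e∈D*

    2≤deg⇒InA : ∀ {v} → 2 ≤ deg M v → InA G v
    2≤deg⇒InA {v} 2≤deg with neighbour M v (≤-trans (s≤s z≤n) 2≤deg)
    ... | y , Mvy with M⊆G* v y Mvy
    ... | _ , inj₁ (v∈A , _)  = v∈A
    ... | _ , inj₂ (v∈D* , _) = contradiction (subst (2 ≤_) (deg-end v∈D*) 2≤deg) (λ { (s≤s ()) })

    partner-unique : ∀ {e a b} → InD* G e → M e a ≡ true → M e b ≡ true → a ≡ b
    partner-unique e∈D* = neighbour-unique M (≤-reflexive (deg-end e∈D*))

    below : Fin n → Fin n → Fin n → Bool
    below a b y = M a y ∧ does (y Fin.<? b)

    rank : Fin n → Fin n → ℕ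
    rank a b = count (below a b)

    ¬below-self : ∀ a b → below a b b ≡ false
    ¬below-self a b = trans (cong (M a b ∧_) (dec-false (b Fin.<? b) (Fin.<-irrefl refl))) (∧-zeroʳ (M a b))

    rank<deg : ∀ {a b} → M a b ≡ true → rank a b < deg M a
    rank<deg {a} {b} Mab = subst (rank a b <_) (sym (deg≡count M a))
      (count-⊂ {p = below a b} {M a} (λ _ → proj₁ ∘ ∧-elim) (¬below-self a b) Mab)

    rank-mono : ∀ {a b b'} → M a b ≡ true → b <ᶠ b' → rank a b < rank a b'
    rank-mono {a} {b} {b'} Mab b<b' = count-⊂ {p = below a b} {below a b'}
      below-b⇒below-b' (¬below-self a b) (∧-intro Mab (dec-true (b Fin.<? b') b<b'))
      where
      below-b⇒below-b' : ∀ y → below a b y ≡ true → below a b' y ≡ true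
      below-b⇒below-b' y h with ∧-elim h
      ... | May , y<b = ∧-intro May (dec-true (y Fin.<? b') (Fin.<-trans (does-true (y Fin.<? b) y<b) b<b'))

    rank-injective : ∀ {a b b'} → M a b ≡ true → M a b' ≡ true → rank a b ≡ rank a b' → b ≡ b'
    rank-injective {a} {b} {b'} Mab Mab' eq with Fin.<-cmp b b'
    ... | tri≈ _ b≡b' _ = b≡b'
    ... | tri< b<b' _ _ = contradiction eq (<⇒≢ (rank-mono Mab b<b'))
    ... | tri> _ _ b'<b = contradiction (sym eq) (<⇒≢ (rank-mono Mab' b'<b))

    -- The edge a–e of M gets colour rank a e, the rank of the end e among the ends of its centre a.
    -- Orienting edges from the endpoint of larger degree finds the centre, except when both ends have
    -- degree 1, and then both orientations give colour 0.
    oriented : ∀ {k} → Fin k → Fin n → Fin n → Bool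
    oriented i a b = M a b ∧ (does (deg M b ≤? deg M a) ∧ does (rank a b ≟ℕ toℕ i))

    colourClass : ∀ {k} → Fin k → EdgeSet n
    colourClass i a b = oriented i a b ∨ oriented i b a

    oriented-elim : ∀ {k} (i : Fin k) a b → oriented i a b ≡ true →
                    M a b ≡ true × deg M b ≤ deg M a × rank a b ≡ toℕ i
    oriented-elim i a b h with ∧-elim {M a b} h
    ... | Mab , rest with ∧-elim {does (deg M b ≤? deg M a)} rest
    ... | ≤deg , ≡rank = Mab , does-true (deg M b ≤? deg M a) ≤deg , does-true (rank a b ≟ℕ toℕ i) ≡rank

    colourClass⊆M : ∀ {k} (i : Fin k) a b → colourClass i a b ≡ true → M a b ≡ true
    colourClass⊆M i a b h with ∨-elim {oriented i a b} h
    ... | inj₁ ab = proj₁ (oriented-elim i a b ab)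
    ... | inj₂ ba = trans (M-sym a b) (proj₁ (oriented-elim i b a ba))

    deg-colourClass≤1 : ∀ {k} (i : Fin k) v → deg (colourClass i) v ≤ 1
    deg-colourClass≤1 i v with deg M v ≤? 1
    ... | yes small = ≤-trans (deg-mono {M = colourClass i} {M} v (colourClass⊆M i v)) small
    ... | no  deg≰1 = deg≤1 (colourClass i) v at-most-one
      where
      outward : ∀ {y} → colourClass i v y ≡ true → oriented i v y ≡ true
      outward {y} h with ∨-elim {oriented i v y} h
      ... | inj₁ vy = vy
      ... | inj₂ yv with oriented-elim i y v yv
      ...   | Myv , deg-v≤deg-y , _ = contradiction (subst (deg M v ≤_) (deg-end y∈D*) deg-v≤deg-y) deg≰1
        where y∈D* = center→end (2≤deg⇒InA (≰⇒> deg≰1)) (trans (M-sym v y) Myv)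
      at-most-one : ∀ y y' → colourClass i v y ≡ true → colourClass i v y' ≡ true → y ≡ y'
      at-most-one y y' h h' with oriented-elim i v y (outward h) | oriented-elim i v y' (outward h')
      ... | Mvy , _ , rank-y | Mvy' , _ , rank-y' = rank-injective Mvy Mvy' (trans rank-y (sym rank-y'))

    colourClass-isStarMatching : ∀ {k} (i : Fin k) → IsStarMatching G (colourClass i)
    colourClass-isStarMatching i =
      (λ a b → ∨-comm (oriented i a b) (oriented i b a)) ,
      (λ a b h → M⊆G* a b (colourClass⊆M i a b h)) ,
      deg-colourClass≤1 i

    hasCover : ∀ k → (∀ a → InA G a → deg M a ≤ k) → HasCover G k
    hasCover k deg≤k = colourClass , colourClass-isStarMatching , covered
      where
      covered : ∀ e → InD* G e → Σ (Fin k) λ i → Σ (Fin n) λ a → colourClass i e a ≡ true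
      covered e e∈D* with neighbour M e (≤-reflexive (sym (deg-end e∈D*)))
      ... | a , Mea = i , a , trans (cong (oriented i e a ∨_) a→e) (∨-zeroʳ (oriented i e a))
        where
        Mae = trans (M-sym a e) Mea
        rank<k : rank a e < k
        rank<k = ≤-trans (rank<deg Mae) (deg≤k a (end→center e∈D* Mea))
        i = fromℕ< rank<k
        a→e : oriented i a e ≡ true
        a→e = ∧-intro Mae (∧-intro (dec-true (deg M e ≤? deg M a) deg-e≤deg-a)
                                   (dec-true (rank a e ≟ℕ toℕ i) (sym (Fin.toℕ-fromℕ< rank<k))))
          where
          deg-e≤deg-a : deg M e ≤ deg M a
          deg-e≤deg-a = subst (_≤ deg M a) (sym (deg-end e∈D*)) (≤-trans (s≤s z≤n) (rank<deg Mae))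

  module Reroute {M : EdgeSet n} (cc : IsCenterCover G M) {u e w : Fin n}
    (u∈A : InA G u) (e∈D* : InD* G e) (w∈A : InA G w)
    (Mue : M u e ≡ true) (ew∈G* : StarEdge G e w) (Mew : M e w ≡ false) where

    open CenterCover cc

    M' : EdgeSet n
    M' = reroute M u e w

    ue⊆M : ∀ x y → edge u e x y ≡ true → M x y ≡ true
    ue⊆M x y h with edge-elim {a = u} {b = e} {x = x} {y = y} h
    ... | inj₁ (refl , refl) = Mue
    ... | inj₂ (refl , refl) = trans (M-sym e u) Mue

    ew∩M=∅ : ∀ x y → edge e w x y ≡ true → M x y ≡ false
    ew∩M=∅ x y h with edge-elim {a = e} {b = w} {x = x} {y = y} h
    ... | inj₁ (refl , refl) = Mew
    ... | inj₂ (refl , refl) = trans (M-sym w e) Mew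

    deg-M' : ∀ x → deg M' x + δ u x ≡ deg M x + δ w x
    deg-M' = deg-reroute M (A≢D* u∈A e∈D*) (A≢D* w∈A e∈D* ∘ sym) ue⊆M ew∩M=∅

    isCenterCover : IsCenterCover G M'
    isCenterCover = symmetric , inStar , deg-ends
      where
      symmetric : Symmetric M'
      symmetric x y rewrite M-sym x y | edge-sym u e x y | edge-sym e w x y = refl
      inStar : InStar G M'
      inStar x y h with ∨-elim {M x y ∧ not (edge u e x y)} h
      ... | inj₁ kept = M⊆G* x y (proj₁ (∧-elim {M x y} kept))
      ... | inj₂ new with edge-elim {a = e} {b = w} {x = x} {y = y} new
      ...   | inj₁ (refl , refl) = ew∈G*
      ...   | inj₂ (refl , refl) = StarEdge-sym ew∈G*
      deg-ends : ∀ x → InD* G x → deg M' x ≡ 1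
      deg-ends x x∈D* = +-cancelʳ-≡ 0 _ _ (begin
        deg M' x + 0       ≡⟨ cong (deg M' x +_) (δ-≢ (A≢D* u∈A x∈D* ∘ sym)) ⟨
        deg M' x + δ u x   ≡⟨ deg-M' x ⟩
        deg M x + δ w x    ≡⟨ cong₂ _+_ (deg-end x∈D*) (δ-≢ (A≢D* w∈A x∈D* ∘ sym)) ⟩
        1 + 0              ∎)
        where open ≡-Reasoning

    agrees-off-e : ∀ {x y} → e ≢ x → e ≢ y → M' x y ≡ M x y
    agrees-off-e {x} {y} e≢x e≢y
      rewrite edge-avoiding {a = u} {b = e} (inj₂ refl) (e≢x ∘ sym) (e≢y ∘ sym)
            | edge-avoiding {a = e} {b = w} (inj₁ refl) (e≢x ∘ sym) (e≢y ∘ sym)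
      = trans (∨-identityʳ _) (∧-identityʳ (M x y))

  Alt-head∈A : ∀ {M a vs b} → Alt G M a vs b → InA G a
  Alt-head∈A (stop a∈A)               = a∈A
  Alt-head∈A (step a∈A _ _ _ _ _ _) = a∈A

  Alt-transfer : ∀ {M M' : EdgeSet n} {e} → InD* G e → (∀ {x y} → e ≢ x → e ≢ y → M' x y ≡ M x y) →
                 ∀ {a vs b} → Alt G M a vs b → All (e ≢_) vs → Alt G M' a vs b
  Alt-transfer e∈D* agrees (stop a∈A) _ = stop a∈A
  Alt-transfer e∈D* agrees (step u∈A e'∈D* ue' Mue' e'w Me'w rest) (_ ∷ e≢e' ∷ e∉rest) =
    step u∈A e'∈D* ue' (trans (agrees (A≢D* u∈A e∈D* ∘ sym) e≢e') Mue')
                   e'w (trans (agrees e≢e' (A≢D* (Alt-head∈A rest) e∈D* ∘ sym)) Me'w)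
         (Alt-transfer e∈D* agrees rest e∉rest)

  flip-alternating : ∀ {M} → IsCenterCover G M → ∀ {a vs b} → Alt G M a vs b → Unique vs →
                     Σ (EdgeSet n) λ M' → IsCenterCover G M' × (∀ x → deg M' x + δ a x ≡ deg M x + δ b x)
  flip-alternating cc (stop _) _ = _ , cc , λ x → refl
  flip-alternating {M} cc {a} {_} {b} (step {w = w} u∈A e∈D* _ Mue ew∈G* Mew rest) (_ ∷ e∉rest ∷ uniq) =
    let M' , cc' , deg-M' = flip-alternating R.isCenterCover (Alt-transfer e∈D* R.agrees-off-e rest e∉rest) uniq
    in  M' , cc' , λ x → +-telescope _ _ _ (δ a x) (δ b x) (δ w x) (deg-M' x) (R.deg-M' x)
    where module R = Reroute cc u∈A e∈D* (Alt-head∈A rest) Mue ew∈G* Mew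

  Alt-last∈A : ∀ {M a vs b} → Alt G M a vs b → InA G b
  Alt-last∈A (stop b∈A)                = b∈A
  Alt-last∈A (step _ _ _ _ _ _ rest) = Alt-last∈A rest

  All-Alt-last : ∀ {M a vs b} {P : Fin n → Set} → Alt G M a vs b → All P vs → P b
  All-Alt-last (stop _)                (pb ∷ _)      = pb
  All-Alt-last (step _ _ _ _ _ _ rest) (_ ∷ _ ∷ ps) = All-Alt-last rest ps

  Alt-++ : ∀ {M a vs b ws c} → Alt G M a vs b → Alt G M b (b ∷ ws) c → Alt G M a (vs ++ ws) c
  Alt-++ (stop _)                         alt' = alt'
  Alt-++ (step u∈A e∈D* ue Mue ew Mew rest) alt' = step u∈A e∈D* ue Mue ew Mew (Alt-++ rest alt')

  matched-end∉path : ∀ {M} → IsCenterCover G M → ∀ {a vs b e} → Alt G M a vs b → Unique vs →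
                     M b e ≡ true → InD* G e → All (_≢ e) vs
  matched-end∉path cc (stop b∈A) _ _ e∈D* = A≢D* b∈A e∈D* ∷ []
  matched-end∉path cc {vs = u ∷ e' ∷ _} {b} {e} (step u∈A _ _ Mue' _ _ rest) (u∉ ∷ _ ∷ uniq) Mbe e∈D* =
    A≢D* u∈A e∈D* ∷ e'≢e ∷ matched-end∉path cc rest uniq Mbe e∈D*
    where
    open CenterCover cc
    e'≢e : e' ≢ e
    e'≢e refl = All-Alt-last rest (All.tail u∉)
                             (partner-unique e∈D* (trans (M-sym e u) Mue') (trans (M-sym e b) Mbe))

  deg≤Δ : ∀ {M d} → HasΔ G M d → ∀ x → deg M x ≤ d
  deg≤Δ {M = M} hΔ x with deg M x in eq
  ... | zero  = z≤n
  ... | suc _ = subst (_≤ _) eq (proj₁ hΔ x (inj₂ (subst (1 ≤_) (sym eq) (s≤s z≤n))))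

  maxCenter⇒deg≡Δ : ∀ {M d w} → HasΔ G M d → IsMaxCenter G M w → deg M w ≡ d
  maxCenter⇒deg≡Δ {M = M} {w = w} hΔ@(_ , v , v∈V , deg-v) (_ , max) =
    ≤-antisym (deg≤Δ hΔ w) (subst (_≤ deg M w) deg-v (max v v∈V))

  module MaxCenters {M : EdgeSet n} (cc : IsCenterCover G M)
    {d} (hΔ : HasΔ G M d) (2≤d : 2 ≤ d) where

    open CenterCover cc

    isMaxCenter⇔deg≡Δ : ∀ w → IsMaxCenter G M w ⇔ deg M w ≡ d
    isMaxCenter⇔deg≡Δ w = mk⇔
      (maxCenter⇒deg≡Δ hΔ)
      (λ deg≡d → 2≤deg⇒InA (subst (2 ≤_) (sym deg≡d) 2≤d) ,
                 λ v _ → subst (deg M v ≤_) (sym deg≡d) (deg≤Δ hΔ v))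

    maxCenters : Subset n
    maxCenters = Vec.tabulate (λ w → does (deg M w ≟ℕ d))

    ∈maxCenters⇔ : ∀ w → w ∈ₛ maxCenters ⇔ deg M w ≡ d
    ∈maxCenters⇔ w = mk⇔ (does-true (deg M w ≟ℕ d) ∘ Equivalence.to (∈-tabulate⇔ _ w))
                         (Equivalence.from (∈-tabulate⇔ _ w) ∘ dec-true (deg M w ≟ℕ d))

    numMaxCenters : NumMaxCenters G M ∣ maxCenters ∣
    numMaxCenters = maxCenters , (λ w → mk⇔ (from (isMaxCenter⇔deg≡Δ w) ∘ to (∈maxCenters⇔ w))
                                           (from (∈maxCenters⇔ w) ∘ to (isMaxCenter⇔deg≡Δ w))) , refl
      where open Equivalence

  -- Switching paths rule out optimality

  module FlipSwitchingPath {Mc : EdgeSet n} (cc : IsCenterCover G Mc) {d} (hΔ : HasΔ G Mc d)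
    {u e vs v} (alt : Alt G Mc u (u ∷ e ∷ vs) v) (uniq : Unique (u ∷ e ∷ vs))
    (u-max : IsMaxCenter G Mc u) (v-small : deg Mc v + 2 ≤ deg Mc u) where

    open CenterCover cc

    deg-u : deg Mc u ≡ d
    deg-u = maxCenter⇒deg≡Δ hΔ u-max

    2+deg-v≤d : 2 + deg Mc v ≤ d
    2+deg-v≤d = subst₂ _≤_ (+-comm (deg Mc v) 2) deg-u v-small

    2≤d : 2 ≤ d
    2≤d = ≤-trans (m≤m+n 2 (deg Mc v)) 2+deg-v≤d

    deg-v<d : deg Mc v < d
    deg-v<d = ≤-trans (n≤1+n _) 2+deg-v≤d

    u≢v : u ≢ v
    u≢v refl = <⇒≢ deg-v<d deg-u

    M' : EdgeSet n
    M' = proj₁ (flip-alternating cc alt uniq)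

    cc' : IsCenterCover G M'
    cc' = proj₁ (proj₂ (flip-alternating cc alt uniq))

    deg-M' : ∀ x → deg M' x + δ u x ≡ deg Mc x + δ v x
    deg-M' = proj₂ (proj₂ (flip-alternating cc alt uniq))

    deg-M'-u : suc (deg M' u) ≡ d
    deg-M'-u = begin
      suc (deg M' u)      ≡⟨ +-comm 1 (deg M' u) ⟩
      deg M' u + 1        ≡⟨ cong (deg M' u +_) (δ-refl u) ⟨
      deg M' u + δ u u    ≡⟨ deg-M' u ⟩
      deg Mc u + δ v u    ≡⟨ cong₂ _+_ deg-u (δ-≢ u≢v) ⟩
      d + 0               ≡⟨ +-identityʳ d ⟩
      d                   ∎
      where open ≡-Reasoning

    deg-M'-v : deg M' v ≡ suc (deg Mc v)
    deg-M'-v = begin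
      deg M' v            ≡⟨ +-identityʳ _ ⟨
      deg M' v + 0        ≡⟨ cong (deg M' v +_) (δ-≢ (u≢v ∘ sym)) ⟨
      deg M' v + δ u v    ≡⟨ deg-M' v ⟩
      deg Mc v + δ v v    ≡⟨ cong (deg Mc v +_) (δ-refl v) ⟩
      deg Mc v + 1        ≡⟨ +-comm (deg Mc v) 1 ⟩
      suc (deg Mc v)      ∎
      where open ≡-Reasoning

    deg-M'-off : ∀ {x} → x ≢ u → x ≢ v → deg M' x ≡ deg Mc x
    deg-M'-off {x} x≢u x≢v = +-cancelʳ-≡ 0 _ _ (begin
      deg M' x + 0        ≡⟨ cong (deg M' x +_) (δ-≢ x≢u) ⟨
      deg M' x + δ u x    ≡⟨ deg-M' x ⟩
      deg Mc x + δ v x    ≡⟨ cong (deg Mc x +_) (δ-≢ x≢v) ⟩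
      deg Mc x + 0        ∎)
      where open ≡-Reasoning

    deg-M'-cases : ∀ x → deg M' x < d ⊎ (x ≢ u × deg M' x ≡ deg Mc x)
    deg-M'-cases x with x Fin.≟ u | x Fin.≟ v
    ... | yes refl | _        = inj₁ (≤-reflexive deg-M'-u)
    ... | no _     | yes refl = inj₁ (subst (_< d) (sym deg-M'-v) 2+deg-v≤d)
    ... | no x≢u   | no x≢v   = inj₂ (x≢u , deg-M'-off x≢u x≢v)

    deg-M'≤d : ∀ x → deg M' x ≤ d
    deg-M'≤d x with deg-M'-cases x
    ... | inj₁ deg<d           = <⇒≤ deg<d
    ... | inj₂ (_ , deg-same) = subst (_≤ d) (sym deg-same) (deg≤Δ hΔ x)

    module _ {w} (w≢u : w ≢ u) (deg-w : deg Mc w ≡ d) where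

      hasΔ' : HasΔ G M' d
      hasΔ' = (λ x _ → deg-M'≤d x) ,
              w , inj₁ (2≤deg⇒InA (subst (2 ≤_) (sym deg-w) 2≤d)) , trans (deg-M'-off w≢u w≢v) deg-w
        where
        w≢v : w ≢ v
        w≢v refl = <⇒≢ deg-v<d deg-w

      open MaxCenters cc hΔ 2≤d using (maxCenters; ∈maxCenters⇔)
      open MaxCenters cc' hasΔ' 2≤d using ()
        renaming (maxCenters to maxCenters'; ∈maxCenters⇔ to ∈maxCenters'⇔)

      fewer-maxCenters : maxCenters' ⊂ maxCenters
      fewer-maxCenters =
        ⊆ , u , from (∈maxCenters⇔ u) deg-u , <⇒≢ (≤-reflexive deg-M'-u) ∘ to (∈maxCenters'⇔ u)
        where
        open Equivalence
        ⊆ : ∀ {x} → x ∈ₛ maxCenters' → x ∈ₛ maxCenters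
        ⊆ {x} x∈ with deg-M'-cases x
        ... | inj₁ deg<d = contradiction (to (∈maxCenters'⇔ x) x∈) (<⇒≢ deg<d)
        ... | inj₂ (_ , deg-same) = from (∈maxCenters⇔ x) (trans (sym deg-same) (to (∈maxCenters'⇔ x) x∈))

    smaller-cover : (∀ w → w ≢ u → deg Mc w ≢ d) → HasCover G (pred d)
    smaller-cover no-other-max = CenterCover.hasCover cc' (pred d) (λ a _ → <⇒≤pred (deg-M'<d a))
      where
      deg-M'<d : ∀ a → deg M' a < d
      deg-M'<d a with deg-M'-cases a
      ... | inj₁ deg<d             = deg<d
      ... | inj₂ (a≢u , deg-same) = subst (_< d) (sym deg-same) (≤∧≢⇒< (deg≤Δ hΔ a) (no-other-max a a≢u))

  switchingPath⇒¬optimal : ∀ {Mc} → IsCenterCover G Mc →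
    (∀ (M' : EdgeSet n) (d N N' : ℕ) → IsCenterCover G M' →
       HasΔ G Mc d → HasΔ G M' d → NumMaxCenters G Mc N → NumMaxCenters G M' N' → N ≤ N') →
    ∀ {d} → HasΔ G Mc d → IsMd G d → ¬ HasSwitchingPath G Mc
  switchingPath⇒¬optimal {Mc} cc fewest-max {d} hΔ (_ , md-least) (u , v , e , vs , alt , uniq , u-max , v-small) =
    contradiction-by (Fin.any? (λ w → ¬? (w Fin.≟ u) ×-dec (deg Mc w ≟ℕ d)))
    where
    module F = FlipSwitchingPath cc hΔ alt uniq u-max v-small
    contradiction-by : Dec (∃ λ w → w ≢ u × deg Mc w ≡ d) → ⊥
    contradiction-by (yes (w , w≢u , deg-w)) =
      <⇒≱ (p⊂q⇒∣p∣<∣q∣ (F.fewer-maxCenters w≢u deg-w))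
          (fewest-max F.M' d _ _ F.cc' hΔ (F.hasΔ' w≢u deg-w) (MaxCenters.numMaxCenters cc hΔ F.2≤d)
                      (MaxCenters.numMaxCenters F.cc' (F.hasΔ' w≢u deg-w) F.2≤d))
    contradiction-by (no ∄w) =
      n≰pred[n] (≤-trans (s≤s z≤n) F.2≤d)
                (md-least (pred d) (F.smaller-cover λ w w≢u deg-w → ∄w (w , w≢u , deg-w)))

  -- Without switching paths the cover is optimal

  module Search {Mc : EdgeSet n} (cc : IsCenterCover G Mc) (no-sw : ¬ HasSwitchingPath G Mc)
    {D} (hΔ : HasΔ G Mc (suc D)) (1≤D : 1 ≤ D)
    {k} (Ms : Fin k → EdgeSet n) (Ms-matching : ∀ i → IsStarMatching G (Ms i))
    (Ms-cover : ∀ e → InD* G e → Σ (Fin k) λ i → Σ (Fin n) λ b → Ms i e b ≡ true) where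

    open CenterCover cc

    u : Fin n
    u = proj₁ (proj₂ hΔ)

    deg-u : deg Mc u ≡ suc D
    deg-u = proj₂ (proj₂ (proj₂ hΔ))

    u∈A : InA G u
    u∈A = 2≤deg⇒InA (subst (2 ≤_) (sym deg-u) (s≤s 1≤D))

    u-max : IsMaxCenter G Mc u
    u-max = u∈A , λ y y∈V → subst (deg Mc y ≤_) (sym deg-u) (proj₁ hΔ y y∈V)

    reachable⇒D≤deg : ∀ {vs a} → Alt G Mc u vs a → Unique vs → D ≤ deg Mc a
    reachable⇒D≤deg (stop _) _ = subst (D ≤_) (sym deg-u) (n≤1+n D)
    reachable⇒D≤deg {a = a} alt@(step {e = e} {vs = ws} _ _ _ _ _ _ _) uniq with deg Mc a + 2 ≤? deg Mc u
    ... | yes small = contradiction (u , a , e , ws , alt , uniq , u-max , small) no-sw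
    ... | no  large = +-cancelʳ-≤ 2 D (deg Mc a) (begin
      D + 2           ≡⟨ +-comm D 2 ⟩
      suc (suc D)     ≡⟨ cong suc deg-u ⟨
      suc (deg Mc u)  ≤⟨ ≰⇒> large ⟩
      deg Mc a + 2    ∎)
      where open ≤-Reasoning

    PathWithin : (Fin n → Bool) → Fin n → Set
    PathWithin s a = Σ (List (Fin n)) λ vs →
      Alt G Mc u vs a × Unique vs × All (λ x → s x ≡ true ⊎ InD* G x) vs

    Reached : (Fin n → Bool) → Set
    Reached s = ∀ {a} → s a ≡ true → PathWithin s a

    Closed : (Fin n → Bool) → Set
    Closed s = ∀ {a e i b} → s a ≡ true → Mc a e ≡ true → Ms i e b ≡ true → s b ≡ true

    module _ {s : Fin n → Bool} (reached : Reached s) (closed : Closed s) where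

      reached∈A : ∀ {a} → s a ≡ true → InA G a
      reached∈A sa = Alt-last∈A (proj₁ (proj₂ (reached sa)))

      reached⇒D≤deg : ∀ {a} → s a ≡ true → D ≤ deg Mc a
      reached⇒D≤deg sa = let _ , alt , uniq , _ = reached sa in reachable⇒D≤deg alt uniq

      ends≤cover : ∀ e → count (λ a → s a ∧ Mc a e) ≤ ∑[ i < k ] count (λ b → s b ∧ Ms i b e)
      ends≤cover e = ≤1⇒≤ (count≤1 _ unique-partner) covered
        where
        unique-partner : ∀ a a' → s a ∧ Mc a e ≡ true → s a' ∧ Mc a' e ≡ true → a ≡ a'
        unique-partner a a' h h' with ∧-elim {s a} h | ∧-elim {s a'} h'
        ... | sa , Mae | _ , Ma'e =
          partner-unique (center→end (reached∈A sa) Mae) (trans (M-sym e a) Mae) (trans (M-sym e a') Ma'e)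
        covered : 0 < count (λ a → s a ∧ Mc a e) → 1 ≤ ∑[ i < k ] count (λ b → s b ∧ Ms i b e)
        covered pos with count>0⇒∃ (λ a → s a ∧ Mc a e) pos
        ... | a , h with ∧-elim {s a} h
        ...   | sa , Mae with Ms-cover e (center→end (reached∈A sa) Mae)
        ...     | i , b , Meb =
          ≤-trans (1≤count (λ b → s b ∧ Ms i b e) (∧-intro (closed sa Mae Meb) Mbe))
                  (term≤∑ (λ i → count (λ b → s b ∧ Ms i b e)) i)
          where Mbe = trans (proj₁ (Ms-matching i) b e) Meb

      reached-deg-sum : s u ≡ true → count s * D < ∑[ a < n ] count (λ e → s a ∧ Mc a e)
      reached-deg-sum su = begin-strict
        count s * D                             ≡⟨ *-distribʳ-sum D (iverson ∘ s) ⟩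
        ∑[ a < n ] (iverson (s a) * D)          <⟨ ∑-mono-< {j = u} D≤deg D<deg-u ⟩
        ∑[ a < n ] (iverson (s a) * deg Mc a)   ≡⟨ sum-cong-≗ deg-as-count ⟩
        ∑[ a < n ] count (λ e → s a ∧ Mc a e)   ∎
        where
        open ≤-Reasoning
        D<deg-u : iverson (s u) * D < iverson (s u) * deg Mc u
        D<deg-u = subst (λ b → iverson b * D < iverson b * deg Mc u) (sym su)
                        (*-monoʳ-< 1 (≤-reflexive (sym deg-u)))
        deg-as-count : ∀ a → iverson (s a) * deg Mc a ≡ count (λ e → s a ∧ Mc a e)
        deg-as-count a = trans (cong (iverson (s a) *_) (deg≡count Mc a)) (sym (count-∧ˡ (s a) (Mc a)))
        D≤deg : ∀ a → iverson (s a) * D ≤ iverson (s a) * deg Mc a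
        D≤deg a with s a in sa
        ... | false = z≤n
        ... | true  = *-monoʳ-≤ 1 (reached⇒D≤deg sa)

      covered-sum : ∑[ e < n ] ∑[ i < k ] count (λ b → s b ∧ Ms i b e) ≤ k * count s
      covered-sum = begin
        ∑[ e < n ] ∑[ i < k ] count (λ b → s b ∧ Ms i b e)
          ≡⟨ ∑-comm (λ e i → count (λ b → s b ∧ Ms i b e)) ⟩
        ∑[ i < k ] ∑[ e < n ] count (λ b → s b ∧ Ms i b e)
          ≡⟨ sum-cong-≗ (λ i → ∑-comm (λ e b → iverson (s b ∧ Ms i b e))) ⟩
        ∑[ i < k ] ∑[ b < n ] count (λ e → s b ∧ Ms i b e)
          ≤⟨ ∑-mono-≤ (λ i → ∑-mono-≤ (matched≤1 i)) ⟩
        ∑[ i < k ] count s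
          ≡⟨ ∑-const k (count s) ⟩
        k * count s
          ∎
        where
        open ≤-Reasoning
        matched≤1 : ∀ i b → count (λ e → s b ∧ Ms i b e) ≤ iverson (s b)
        matched≤1 i b = begin
          count (λ e → s b ∧ Ms i b e)    ≡⟨ count-∧ˡ (s b) (Ms i b) ⟩
          iverson (s b) * count (Ms i b)  ≤⟨ *-monoʳ-≤ (iverson (s b)) matching ⟩
          iverson (s b) * 1               ≡⟨ *-identityʳ (iverson (s b)) ⟩
          iverson (s b)                   ∎
          where matching = subst (_≤ 1) (deg≡count (Ms i) b) (proj₂ (proj₂ (Ms-matching i)) b)

      closed⇒D<k : s u ≡ true → D < k
      closed⇒D<k su = *-cancelʳ-< (count s) D k (begin-strict
        D * count s                                            ≡⟨ *-comm D (count s) ⟩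
        count s * D                                            <⟨ reached-deg-sum su ⟩
        ∑[ a < n ] count (λ e → s a ∧ Mc a e)                 ≡⟨ ∑-comm (λ a e → iverson (s a ∧ Mc a e)) ⟩
        ∑[ e < n ] count (λ a → s a ∧ Mc a e)                 ≤⟨ ∑-mono-≤ ends≤cover ⟩
        ∑[ e < n ] ∑[ i < k ] count (λ b → s b ∧ Ms i b e)    ≤⟨ covered-sum ⟩
        k * count s                                            ∎)
        where open ≤-Reasoning

    insert : Fin n → (Fin n → Bool) → Fin n → Bool
    insert b s x = s x ∨ does (x Fin.≟ b)

    insert-self : ∀ s b → insert b s b ≡ true
    insert-self s b = trans (cong (s b ∨_) (dec-true (b Fin.≟ b) refl)) (∨-zeroʳ (s b))

    Violation : (Fin n → Bool) → Set
    Violation s = Σ (Fin n) λ a → Σ (Fin n) λ e → Σ (Fin k) λ i → Σ (Fin n) λ b →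
                  s a ≡ true × Mc a e ≡ true × Ms i e b ≡ true × s b ≡ false

    violation? : ∀ s → Dec (Violation s)
    violation? s = Fin.any? λ a → Fin.any? λ e → Fin.any? λ i → Fin.any? λ b →
      (s a Bool.≟ true) ×-dec (Mc a e Bool.≟ true) ×-dec (Ms i e b Bool.≟ true) ×-dec (s b Bool.≟ false)

    ¬violation⇒closed : ∀ {s} → ¬ Violation s → Closed s
    ¬violation⇒closed {s} none {a} {e} {i} {b} sa Mae Meb with s b in sb
    ... | true  = refl
    ... | false = contradiction (a , e , i , b , sa , Mae , Meb , sb) none

    weaken : ∀ s b {y} → s y ≡ true ⊎ InD* G y → insert b s y ≡ true ⊎ InD* G y
    weaken s b (inj₁ sy)   = inj₁ (cong (_∨ _) sy)
    weaken s b (inj₂ y∈D*) = inj₂ y∈D*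

    extend-path : ∀ {s a e i b} → PathWithin s a → s a ≡ true →
                  Mc a e ≡ true → Ms i e b ≡ true → s b ≡ false → PathWithin (insert b s) b
    extend-path {s} {a} {e} {i} {b} (vs , alt , uniq , within) sa Mae Meb sb =
      vs ++ e ∷ b ∷ [] ,
      Alt-++ alt (step a∈A e∈D* (M⊆G* a e Mae) Mae eb Meb≡false (stop b∈A)) ,
      AllPairs.++⁺ uniq ((e≢b ∷ []) ∷ [] ∷ [])
        (All.zipWith (λ (≢e , ≢b) → ≢e ∷ ≢b ∷ [])
                     (matched-end∉path cc alt uniq Mae e∈D* , All.map ≢b within)) ,
      All.++⁺ (All.map (weaken s b) within) (inj₂ e∈D* ∷ inj₁ (insert-self s b) ∷ [])
      where
      a∈A = Alt-last∈A alt
      e∈D* = center→end a∈A Mae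
      eb = proj₁ (proj₂ (Ms-matching i)) e b Meb
      b∈A = StarEdge-D*→A eb e∈D*
      e≢b : e ≢ b
      e≢b = A≢D* b∈A e∈D* ∘ sym
      Meb≡false : Mc e b ≡ false
      Meb≡false = ¬-not λ Meb →
        not-¬ sb (subst (λ y → s y ≡ true) (partner-unique e∈D* (trans (M-sym e a) Mae) Meb) sa)
      ≢b : ∀ {y} → s y ≡ true ⊎ InD* G y → y ≢ b
      ≢b (inj₁ sy)   refl = not-¬ sb sy
      ≢b (inj₂ y∈D*) refl = A≢D* b∈A y∈D* refl

    extend : ∀ {s a e i b} → Reached s → s a ≡ true →
             Mc a e ≡ true → Ms i e b ≡ true → s b ≡ false → Reached (insert b s)
    extend {s} {b = b} reached sa Mae Meb sb {x} h with ∨-elim {s x} h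
    ... | inj₁ sx = let vs , alt , uniq , within = reached sx in vs , alt , uniq , All.map (weaken s b) within
    ... | inj₂ x≟b with refl ← does-true (x Fin.≟ b) x≟b = extend-path (reached sa) sa Mae Meb sb

    outside : (Fin n → Bool) → ℕ
    outside s = count (not ∘ s)

    outside-insert : ∀ {s b} → s b ≡ false → outside (insert b s) < outside s
    outside-insert {s} {b} sb =
      count-⊂ {p = not ∘ insert b s} {q = not ∘ s} shrink (cong not (insert-self s b)) (cong not sb)
      where
      shrink : ∀ x → not (insert b s x) ≡ true → not (s x) ≡ true
      shrink x with s x
      ... | false = λ _ → refl
      ... | true  = λ ()

    grow : ∀ s → Acc _<_ (outside s) → s u ≡ true → Reached s →
           Σ (Fin n → Bool) λ s' → s' u ≡ true × Reached s' × Closed s'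
    grow s (acc smaller) su reached with violation? s
    ... | no none = s , su , reached , ¬violation⇒closed none
    ... | yes (a , e , i , b , sa , Mae , Meb , sb) =
      grow (insert b s) (smaller (outside-insert sb)) (cong (_∨ _) su) (extend reached sa Mae Meb sb)

    start : Reached (λ x → does (x Fin.≟ u))
    start {a} h with refl ← does-true (a Fin.≟ u) h = u ∷ [] , stop u∈A , [] ∷ [] , inj₁ h ∷ []

    D<k : D < k
    D<k with s , su , reached , closed ← grow _ (<-wellFounded _) (dec-true (u Fin.≟ u) refl) start =
      closed⇒D<k reached closed su

  noSwitchingPath⇒optimal : ∀ {Mc} → IsCenterCover G Mc → ¬ HasSwitchingPath G Mc →
                            ∀ {d} → HasΔ G Mc d → IsMd G d
  noSwitchingPath⇒optimal {Mc} cc no-sw {d} hΔ =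
    hasCover d (λ a a∈A → proj₁ hΔ a (inj₁ a∈A)) , λ k cover → ≮⇒≥ (too-few hΔ cover)
    where
    open CenterCover cc
    too-few : ∀ {d k} → HasΔ G Mc d → HasCover G k → k < d → ⊥
    too-few {suc zero} {zero} (_ , x , _ , deg-x) (_ , _ , covers) _
      with y , Mxy ← neighbour Mc x (≤-reflexive (sym deg-x))
      with e , e∈D* ← StarEdge-end (M⊆G* x y Mxy)
      with () ← proj₁ (covers e e∈D*)
    too-few {suc zero} {suc _} _ _ (s≤s ())
    too-few {suc (suc D)} hΔ (Ms , matching , covers) k<d =
      <⇒≱ (Search.D<k cc no-sw hΔ (s≤s z≤n) Ms matching covers) (≤-pred k<d)

lemma4 : ∀ {n} (G : Graph n) → Connected G → Σ (Fin n) (InA G) →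
         (Mc : EdgeSet n) → IsCenterCover G Mc →
         (∀ (M' : EdgeSet n) (d N N' : ℕ) → IsCenterCover G M' →
            HasΔ G Mc d → HasΔ G M' d →
            NumMaxCenters G Mc N → NumMaxCenters G M' N' → N ≤ N') →
         (d : ℕ) → HasΔ G Mc d →
         (IsMd G d ⇔ (¬ HasSwitchingPath G Mc))
lemma4 G _ _ Mc cc fewest-max d hΔ =
  mk⇔ (switchingPath⇒¬optimal G cc fewest-max hΔ) (λ no-sw → noSwitchingPath⇒optimal G cc no-sw hΔ)
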